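{- Let $G=(V,E)$ be a finite simple graph and let $A$ be an arc set of $G$ such that the directed graph $H=(V,A)$ consists of a collection of vertex-disjoint directed paths. Then $A$ is a forcing arc set of $G$ if and only if $A$ does not contain a chain twist.
   Context: Zero forcing: vertices are coloured blue or white; a blue vertex $u$ may force (recolour blue) a white neighbour $v$ if $v$ is the only white vertex in the closed neighbourhood $N[u]$. A zero forcing set of $G$ is a set $B_0$ such that starting with exactly $B_0$ blue and repeatedly applying this rule, all vertices eventually become blue; $Z(G)$ is the minimum size of a zero forcing set. An arc set of $G$ is a set $A$ of ordered pairs $(u,v)$ with $uv\in E$, such that $(u,v)\in A$ implies $(v,u)\notin A$. A source (resp. sink) of $A$ is a vertex of in-degree (resp. out-degree) zero in $(V,A)$. $A$ is a forcing arc set of $G$ if (P1) $(V,A)$ is a collection of vertex-disjoint directed paths (possibly of length zero), and (P2) there is a zero forcing process on $G$, in which each white vertex is forced by exactly one vertex and all vertices become blue, such that $(u,v)\in A$ exactly when $u$ forces $v$ during the process; the initial blue set of this process is the set of sources of $A$. A chain twist in $A$ is a cycle $v_0v_1\dots v_{k-1}v_0$ in $G$ such that for all $i$ (indices modulo $k$): if $(v_i,v_{i+1})\notin A$ then $(v_{i-1},v_i)\in A$ and $(v_{i+1},v_{i+2})\in A$. $A$ contains a chain twist if some cycle of $G$ satisfies this condition. -}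

module Defs where

open import Data.Bool using (Bool; true; false)
open import Data.Nat using (ℕ; zero; suc; _+_)
open import Data.Nat.DivMod using (_mod_)
open import Data.Fin using (Fin; toℕ)
open import Data.Product using (Σ; _×_; _,_; proj₂; ∃)
open import Data.Sum using (_⊎_)
open import Data.List using (List; []; _∷_; _++_; map)
open import Data.List.Membership.Propositional using (_∈_)
open import Data.Unit using (⊤)
open import Relation.Nullary using (¬_)
open import Relation.Binary.PropositionalEquality using (_≡_; _≢_)
open import Relation.Binary.Construct.Closure.Transitive using (TransClosure)
open import Function.Bundles using (_⇔_)

record Graph (n : ℕ) : Set where
  field
    adj     : Fin n → Fin n → Bool
    adj-sym : ∀ u v → adj u v ≡ adj v u
    adj-irr : ∀ v → adj v v ≡ false
open Graph public

Adj : ∀ {n} → Graph n → Fin n → Fin n → Set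
Adj G u v = adj G u v ≡ true

record ArcSet {n : ℕ} (G : Graph n) : Set where
  field
    arc      : Fin n → Fin n → Bool
    arc-edge : ∀ u v → arc u v ≡ true → Adj G u v
    arc-anti : ∀ u v → arc u v ≡ true → arc v u ≡ false
open ArcSet public

Arc : ∀ {n} {G : Graph n} → ArcSet G → Fin n → Fin n → Set
Arc A u v = arc A u v ≡ true

IsSource : ∀ {n} {G : Graph n} → ArcSet G → Fin n → Set
IsSource A v = ∀ u → ¬ Arc A u v

-- (P1): (V,A) is a collection of vertex-disjoint directed paths:
-- in-degree ≤ 1, out-degree ≤ 1, and no directed cycle.
P1 : ∀ {n} {G : Graph n} → ArcSet G → Set
P1 {n} A =
  (∀ u u' v → Arc A u v → Arc A u' v → u ≡ u') ×
  (∀ u v v' → Arc A u v → Arc A u v' → v ≡ v') ×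
  (∀ v → ¬ TransClosure (Arc A) v v)

-- Zero forcing process, recorded as the ordered list of forces (u , v) = "u forces v".
-- A vertex is blue after the forces `done` if it is initially blue or was forced in `done`.
Blue : ∀ {n} → (Fin n → Set) → List (Fin n × Fin n) → Fin n → Set
Blue B0 done w = B0 w ⊎ w ∈ map proj₂ done

ForceStep : ∀ {n} → Graph n → (Fin n → Set) → List (Fin n × Fin n) → Fin n → Fin n → Set
ForceStep G B0 done u v =
  Adj G u v × Blue B0 done u × ¬ Blue B0 done v ×
  (∀ w → Adj G u w → w ≢ v → Blue B0 done w)

ValidFrom : ∀ {n} → Graph n → (Fin n → Set) → List (Fin n × Fin n) → List (Fin n × Fin n) → Set
ValidFrom G B0 done [] = ⊤
ValidFrom G B0 done ((u , v) ∷ rest) =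
  ForceStep G B0 done u v × ValidFrom G B0 (done ++ ((u , v) ∷ [])) rest

-- The process starts with exactly the
-- sources of A blue, each white vertex is forced (exactly once, since forced vertices are white),
-- all vertices end blue, and (u,v) ∈ A iff u forces v in the process.
ForcingArcSet : ∀ {n} (G : Graph n) → ArcSet G → Set
ForcingArcSet {n} G A =
  P1 A ×
  Σ (List (Fin n × Fin n)) λ forces →
    ValidFrom G (IsSource A) [] forces ×
    (∀ w → Blue (IsSource A) forces w) ×
    (∀ u v → Arc A u v ⇔ (u , v) ∈ forces)

next : ∀ {m} → Fin (3 + m) → Fin (3 + m)
next {m} i = suc (toℕ i) mod (3 + m)

prev : ∀ {m} → Fin (3 + m) → Fin (3 + m)
prev {m} i = (toℕ i + (2 + m)) mod (3 + m)

record Cycle {n : ℕ} (G : Graph n) : Set where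
  field
    m      : ℕ
    vtx    : Fin (3 + m) → Fin n
    inj    : ∀ i j → vtx i ≡ vtx j → i ≡ j
    adjs   : ∀ i → Adj G (vtx i) (vtx (next i))
open Cycle public

IsChainTwist : ∀ {n} {G : Graph n} → ArcSet G → Cycle G → Set
IsChainTwist A C =
  ∀ i → ¬ Arc A (vtx C i) (vtx C (next i)) →
    Arc A (vtx C (prev i)) (vtx C i) ×
    Arc A (vtx C (next i)) (vtx C (next (next i)))

ContainsChainTwist : ∀ {n} (G : Graph n) → ArcSet G → Set
ContainsChainTwist G A = Σ (Cycle G) λ C → IsChainTwist A C

module Submission where

open import Defs
open import Data.Bool using (true)
open import Data.Bool.Properties using () renaming (_≟_ to _≟ᵇ_)
open import Data.Empty using (⊥-elim)
open import Data.Fin using (Fin; zero; suc; toℕ)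
open import Data.Fin.Properties using (toℕ-fromℕ<; toℕ-injective; toℕ<n; pigeonhole; any?; all?; _≟_)
open import Data.List using (List; []; _∷_; [_]; _++_; map; filter; length; allFin)
open import Data.List.Properties using (++-assoc; ++-identityʳ; map-++; filter-notAll; filter-reject)
open import Data.List.Membership.Propositional using (_∈_; _∉_; lose)
open import Data.List.Membership.Propositional.Properties
  using (∈-map⁻; ∈-map⁺; ∈-++⁻; ∈-++⁺ˡ; ∈-++⁺ʳ; ∈-filter⁺; ∈-allFin)
import Data.List.Membership.DecPropositional as DecMembership
open import Data.List.Relation.Unary.Any using (here)
open import Data.Nat using (ℕ; zero; suc; _+_; _∸_; _<_; _≤_; s≤s; s≤s⁻¹; _%_)
open import Data.Nat.DivMod using (m%n<n; m<n⇒m%n≡m; n%n≡0; [m+n]%n≡m%n; %-distribˡ-+)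
open import Data.Nat.GeneralisedArithmetic using (fold; fold-+)
open import Data.Nat.Induction using (<-wellFounded)
open import Data.Nat.Properties
  using ( n<1+n; +-suc; +-∸-assoc; m∸n+n≡m; m∸n≤m; ∸-cancelˡ-≡; n∸n≡0; +-monoʳ-<; <-cmp; m≤n⇒m<n∨m≡n
        ; m≢1+n+m; suc-injective)
open import Data.Product using (Σ; ∃; ∃₂; _×_; _,_; proj₁; proj₂)
open import Data.Sum using (_⊎_; inj₁; inj₂)
open import Data.Unit using (tt)
open import Function using (_∘_)
open import Function.Bundles using (_⇔_; mk⇔; Equivalence)
open import Induction.WellFounded using (Acc; acc)
open import Relation.Binary.Definitions using (tri<; tri≈; tri>)
open import Relation.Binary.PropositionalEquality
  using (_≡_; _≢_; refl; sym; trans; cong; subst; module ≡-Reasoning)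
open import Relation.Nullary using (¬_; Dec; yes; no; contradiction)
open import Relation.Nullary.Decidable using (_×-dec_; _⊎-dec_; _→-dec_; ¬?; decidable-stable)
open import Relation.Unary using (Decidable)

-- (⇒) Along a chain twist v₀ … v_{k-1}, as long as no cycle edge (vᵢ,vᵢ₊₁) has been used as a force,
-- every blue vᵢ has a white predecessor vᵢ₋₁: the head of an arc turns blue only by a force along that
-- arc, so (vᵢ₋₁,vᵢ) ∉ A, and then the twist condition puts the still unused arc (vᵢ₋₂,vᵢ₋₁) into A.  As
-- vᵢ₋₁ is a neighbour of vᵢ other than vᵢ₊₁, vᵢ can never force vᵢ₊₁; hence not every vertex turns blue.
-- (⇐) Force greedily along the arcs of A.  If this stalls with a white vertex left, walk backwards: from a
-- white vertex to the tail of its in-arc, and from a blue vertex whose arc points to a white vertex to a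
-- second white neighbour, which exists because that force is blocked and is not joined to it by an arc.
-- The walk eventually cycles, with period at least 3, and the cycle read forwards is a chain twist.

module _ {m : ℕ} where

  toℕ-next : (i : Fin (3 + m)) → toℕ (next i) ≡ suc (toℕ i) % (3 + m)
  toℕ-next i = toℕ-fromℕ< (m%n<n (suc (toℕ i)) (3 + m))

  toℕ-prev : (i : Fin (3 + m)) → toℕ (prev i) ≡ (toℕ i + (2 + m)) % (3 + m)
  toℕ-prev i = toℕ-fromℕ< (m%n<n (toℕ i + (2 + m)) (3 + m))

  next-prev : (i : Fin (3 + m)) → next (prev i) ≡ i
  next-prev i = toℕ-injective (begin
    toℕ (next (prev i))                          ≡⟨ toℕ-next (prev i) ⟩
    suc (toℕ (prev i)) % (3 + m)                 ≡⟨ cong (λ k → suc k % (3 + m)) (toℕ-prev i) ⟩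
    (1 + (toℕ i + (2 + m)) % (3 + m)) % (3 + m)  ≡⟨ sym (%-distribˡ-+ 1 (toℕ i + (2 + m)) (3 + m)) ⟩
    suc (toℕ i + (2 + m)) % (3 + m)              ≡⟨ cong (_% (3 + m)) (sym (+-suc (toℕ i) (2 + m))) ⟩
    (toℕ i + (3 + m)) % (3 + m)                  ≡⟨ [m+n]%n≡m%n (toℕ i) (3 + m) ⟩
    toℕ i % (3 + m)                              ≡⟨ m<n⇒m%n≡m (toℕ<n i) ⟩
    toℕ i                                        ∎)
    where open ≡-Reasoning

  next-cases : (i : Fin (3 + m)) →
    (suc (toℕ i) < 3 + m × toℕ (next i) ≡ suc (toℕ i)) ⊎ (suc (toℕ i) ≡ 3 + m × next i ≡ zero)
  next-cases i with m≤n⇒m<n∨m≡n (toℕ<n i)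
  ... | inj₁ lt = inj₁ (lt , trans (toℕ-next i) (m<n⇒m%n≡m lt))
  ... | inj₂ eq =
        inj₂ (eq , toℕ-injective (trans (toℕ-next i) (trans (cong (_% (3 + m)) eq) (n%n≡0 (3 + m)))))

  next²≢id : (i : Fin (3 + m)) → next (next i) ≢ i
  next²≢id i eq with next-cases i
  ... | inj₂ (last , next≡0) =
        contradiction (trans (cong (λ j → 1 + toℕ j) (trans (cong next (sym next≡0)) eq)) last) λ ()
  ... | inj₁ (_ , toℕ-next≡) with next-cases (next i)
  ...   | inj₁ (_ , toℕ-next²≡) =
          m≢1+n+m (toℕ i) (trans (sym (cong toℕ eq)) (trans toℕ-next²≡ (cong (1 +_) toℕ-next≡)))
  ...   | inj₂ (last , next²≡0) =
          contradiction (trans (cong (λ j → 2 + toℕ j) (trans (sym next²≡0) eq))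
                               (trans (cong (1 +_) (sym toℕ-next≡)) last)) λ ()

  prev≢next : (i : Fin (3 + m)) → prev i ≢ next i
  prev≢next i eq = next²≢id i (trans (cong next (sym eq)) (next-prev i))

least-witness : {P : ℕ → Set} → Decidable P → ∀ {d} → P d → ∃ λ k → P k × (∀ {j} → j < k → ¬ P j)
least-witness P? {d} Pd with P? 0
... | yes P0 = 0 , P0 , λ ()
least-witness P? {zero} P0 | no ¬P0 = contradiction P0 ¬P0
least-witness P? {suc d} Pd | no ¬P0 with least-witness (P? ∘ suc) Pd
... | k , Pk , below = suc k , Pk , λ { {zero} _ → ¬P0 ; {suc j} j<k → below (s≤s⁻¹ j<k) }

record Period {X : Set} (f : X → X) (y : X) (p : ℕ) : Set where
  field
    returns            : fold y f p ≡ y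
    iterates-injective : ∀ {a c} → a < p → c < p → fold y f a ≡ fold y f c → a ≡ c

eventually-periodic : ∀ {n} (f : Fin n → Fin n) (x : Fin n) → ∃₂ λ s k → Period f (fold x f s) (suc k)
eventually-periodic {n} f x with pigeonhole (n<1+n n) (fold x f ∘ toℕ)
... | i , j , i<j , collision = toℕ i , k , record { returns = returns-after-k ; iterates-injective = injective }
  where
  open ≡-Reasoning
  y : Fin n
  y = fold x f (toℕ i)

  t : ℕ
  t = toℕ j ∸ suc (toℕ i)

  Returns : ℕ → Set
  Returns q = fold y f (suc q) ≡ y

  returns-after-t : Returns t
  returns-after-t = begin
    fold y f (suc t)          ≡⟨ sym (fold-+ x f (suc t)) ⟩
    fold x f (suc t + toℕ i)  ≡⟨ cong (fold x f) (trans (sym (+-suc t (toℕ i))) (m∸n+n≡m i<j)) ⟩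
    fold x f (toℕ j)          ≡⟨ sym collision ⟩
    y                         ∎

  minimal : ∃ λ k → Returns k × (∀ {q} → q < k → ¬ Returns q)
  minimal = least-witness (λ q → fold y f (suc q) ≟ y) {t} returns-after-t

  k : ℕ
  k = proj₁ minimal

  returns-after-k : Returns k
  returns-after-k = proj₁ (proj₂ minimal)

  no-early-collision : ∀ {a c} → a < c → c ≤ k → fold y f a ≢ fold y f c
  no-early-collision {a} {c} a<c c≤k fa≡fc = proj₂ (proj₂ minimal) earlier returns-earlier
    where
    gap : ℕ
    gap = k ∸ c
    gap+c≡k : gap + c ≡ k
    gap+c≡k = m∸n+n≡m c≤k
    earlier : gap + a < k
    earlier = subst (gap + a <_) gap+c≡k (+-monoʳ-< gap a<c)
    returns-earlier : Returns (gap + a)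
    returns-earlier = begin
      fold y f (suc gap + a)         ≡⟨ fold-+ y f (suc gap) ⟩
      fold (fold y f a) f (suc gap)  ≡⟨ cong (λ z → fold z f (suc gap)) fa≡fc ⟩
      fold (fold y f c) f (suc gap)  ≡⟨ sym (fold-+ y f (suc gap)) ⟩
      fold y f (suc (gap + c))       ≡⟨ cong (fold y f ∘ suc) gap+c≡k ⟩
      fold y f (suc k)               ≡⟨ returns-after-k ⟩
      y                              ∎

  injective : ∀ {a c} → a < suc k → c < suc k → fold y f a ≡ fold y f c → a ≡ c
  injective {a} {c} a<1+k c<1+k fa≡fc with <-cmp a c
  ... | tri< a<c _ _ = contradiction fa≡fc (no-early-collision a<c (s≤s⁻¹ c<1+k))
  ... | tri≈ _ a≡c _ = a≡c
  ... | tri> _ _ c<a = contradiction (sym fa≡fc) (no-early-collision c<a (s≤s⁻¹ a<1+k))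

fold-preserves : ∀ {X : Set} {f : X → X} {P : X → Set} → (∀ {x} → P x → P (f x)) →
                 ∀ {y} → P y → ∀ k → P (fold y f k)
fold-preserves P-f Py zero = Py
fold-preserves {P = P} P-f Py (suc k) = P-f (fold-preserves {P = P} P-f Py k)

module _ {n : ℕ} (G : Graph n) {f : Fin n → Fin n} {Inv : Fin n → Set}
         (f-preserves : ∀ {x} → Inv x → Inv (f x)) (f-adjacent : ∀ {x} → Inv x → Adj G (f x) x) where

  reversed-orbit : ∀ m {y} → Inv y → Period f y (3 + m) →
                   Σ (Cycle G) λ C → (∀ i → f (vtx C (next i)) ≡ vtx C i) × (∀ i → Inv (vtx C i))
  reversed-orbit m {y} Inv-y period = C , f-next , Inv-v
    where
    open Period period
    open ≡-Reasoning

    v : Fin (3 + m) → Fin n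
    v i = fold y f ((2 + m) ∸ toℕ i)

    Inv-v : ∀ i → Inv (v i)
    Inv-v i = fold-preserves {P = Inv} f-preserves Inv-y ((2 + m) ∸ toℕ i)

    f-next : ∀ i → f (v (next i)) ≡ v i
    f-next i with next-cases i
    ... | inj₁ (lt , toℕ-next≡) =
          trans (cong (λ j → fold y f (suc ((2 + m) ∸ j))) toℕ-next≡)
                (cong (fold y f) (sym (+-∸-assoc 1 (s≤s⁻¹ (s≤s⁻¹ lt)))))
    ... | inj₂ (last , next≡0) = begin
          f (v (next i))     ≡⟨ cong (f ∘ v) next≡0 ⟩
          fold y f (3 + m)   ≡⟨ returns ⟩
          y                  ≡⟨ cong (fold y f) (sym (trans (cong ((2 + m) ∸_) (suc-injective last))
                                                              (n∸n≡0 (2 + m)))) ⟩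
          v i                ∎

    v-injective : ∀ i j → v i ≡ v j → i ≡ j
    v-injective i j vi≡vj = toℕ-injective (∸-cancelˡ-≡ (s≤s⁻¹ (toℕ<n i)) (s≤s⁻¹ (toℕ<n j))
      (iterates-injective (s≤s (m∸n≤m (2 + m) (toℕ i))) (s≤s (m∸n≤m (2 + m) (toℕ j))) vi≡vj))

    C : Cycle G
    C = record { m = m ; vtx = v ; inj = v-injective
               ; adjs = λ i → subst (λ w → Adj G w (v (next i))) (f-next i) (f-adjacent (Inv-v (next i))) }

module _ {X : Set} {P Q : X → Set} (P? : Decidable P) (Q? : Decidable Q) (Q⇒P : ∀ {x} → Q x → P x) where

  filter-absorbs : ∀ xs → filter Q? (filter P? xs) ≡ filter Q? xs
  filter-absorbs [] = refl
  filter-absorbs (x ∷ xs) with P? x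
  ... | no ¬Px = trans (filter-absorbs xs) (sym (filter-reject Q? (¬Px ∘ Q⇒P)))
  ... | yes _ with Q? x
  ...   | yes _ = cong (x ∷_) (filter-absorbs xs)
  ...   | no _  = filter-absorbs xs

  length-filter-< : ∀ {x xs} → x ∈ xs → P x → ¬ Q x → length (filter Q? xs) < length (filter P? xs)
  length-filter-< {x} {xs} x∈xs Px ¬Qx =
    subst (λ ys → length ys < length (filter P? xs)) (filter-absorbs xs)
          (filter-notAll Q? (filter P? xs) (lose (∈-filter⁺ P? x∈xs Px) ¬Qx))

module _ {n : ℕ} {G : Graph n} (A : ArcSet G) where

  private
    B₀ : Fin n → Set
    B₀ = IsSource A

  Forces : Set
  Forces = List (Fin n × Fin n)

  White : Forces → Fin n → Set
  White d v = ¬ Blue B₀ d v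

  ArcForces : Forces → Set
  ArcForces d = ∀ {u v} → (u , v) ∈ d → Arc A u v

  arc? : ∀ u v → Dec (Arc A u v)
  arc? u v = arc A u v ≟ᵇ true

  arc-irreflexive : ∀ v → ¬ Arc A v v
  arc-irreflexive v a with trans (sym (adj-irr G v)) (arc-edge A v v a)
  ... | ()

  arc-asymmetric : ∀ {u v} → Arc A u v → ¬ Arc A v u
  arc-asymmetric {u} {v} uv vu with trans (sym (arc-anti A u v uv)) vu
  ... | ()

  private
    open DecMembership (_≟_ {n}) using (_∈?_)

    adj? : ∀ u v → Dec (Adj G u v)
    adj? u v = adj G u v ≟ᵇ true

    source? : ∀ v → Dec (B₀ v)
    source? v = all? λ u → ¬? (arc? u v)

    blue? : ∀ d v → Dec (Blue B₀ d v)
    blue? d v = source? v ⊎-dec (v ∈? map proj₂ d)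

    white? : ∀ d → Decidable (White d)
    white? d v = ¬? (blue? d v)

    forceStep? : ∀ d u v → Dec (ForceStep G B₀ d u v)
    forceStep? d u v = adj? u v ×-dec blue? d u ×-dec white? d v ×-dec
                       all? (λ w → adj? u w →-dec (¬? (w ≟ v) →-dec blue? d w))

  Blue-++ : ∀ d e {w} → Blue B₀ d w → Blue B₀ (d ++ e) w
  Blue-++ d e (inj₁ source) = inj₁ source
  Blue-++ d e {w} (inj₂ forced) = inj₂ (subst (w ∈_) (sym (map-++ proj₂ d e)) (∈-++⁺ˡ forced))

  forced-blue : ∀ d u v → Blue B₀ (d ++ [ (u , v) ]) v
  forced-blue d u v = inj₂ (∈-map⁺ proj₂ (∈-++⁺ʳ d (here refl)))

  ValidFrom-snoc : ∀ d xs {u v} → ValidFrom G B₀ d xs → ForceStep G B₀ (d ++ xs) u v →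
                   ValidFrom G B₀ d (xs ++ [ (u , v) ])
  ValidFrom-snoc d [] {u} {v} _ step = subst (λ e → ForceStep G B₀ e u v) (++-identityʳ d) step , tt
  ValidFrom-snoc d (x ∷ xs) {u} {v} (first , rest) step =
    first , ValidFrom-snoc (d ++ [ x ]) xs rest (subst (λ e → ForceStep G B₀ e u v) (sym (++-assoc d [ x ] xs)) step)

  whites : Forces → List (Fin n)
  whites d = filter (white? d) (allFin n)

  forcing-shrinks-whites : ∀ {d u v} → ForceStep G B₀ d u v → length (whites (d ++ [ (u , v) ])) < length (whites d)
  forcing-shrinks-whites {d} {u} {v} (_ , _ , white-v , _) =
    length-filter-< (white? d) (white? (d ++ [ (u , v) ])) (λ white → white ∘ Blue-++ d _)
      (∈-allFin v) white-v (λ white → white (forced-blue d u v))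

  module _ (p1 : P1 A) where

    private
      in-unique : ∀ {u u' v} → Arc A u v → Arc A u' v → u ≡ u'
      in-unique = proj₁ p1 _ _ _

      out-unique : ∀ {u v v'} → Arc A u v → Arc A u v' → v ≡ v'
      out-unique = proj₁ (proj₂ p1) _ _ _

    arc-into-blue⇒forced : ∀ {d u v} → ArcForces d → Arc A u v → Blue B₀ d v → (u , v) ∈ d
    arc-into-blue⇒forced arcs a (inj₁ source) = contradiction a (source _)
    arc-into-blue⇒forced arcs a (inj₂ forced) with ∈-map⁻ proj₂ forced
    ... | (u' , _) , u'v∈d , refl with in-unique (arcs u'v∈d) a
    ... | refl = u'v∈d

    module _ (C : Cycle G) (twist : IsChainTwist A C) where

      private
        v : Fin (3 + m C) → Fin n
        v = vtx C

      CycleUnforced : Forces → Set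
      CycleUnforced d = ∀ i → (v i , v (next i)) ∉ d

      adj-prev : ∀ i → Adj G (v i) (v (prev i))
      adj-prev i = trans (adj-sym G (v i) (v (prev i)))
                         (subst (λ j → Adj G (v (prev i)) (v j)) (next-prev i) (adjs C (prev i)))

      module _ {d : Forces} (arcs : ArcForces d) (unforced : CycleUnforced d) where

        arc-into-cycle-white : ∀ i → Arc A (v (prev i)) (v i) → White d (v i)
        arc-into-cycle-white i a blue = unforced (prev i)
          (subst (λ j → (v (prev i) , v j) ∈ d) (sym (next-prev i)) (arc-into-blue⇒forced arcs a blue))

        blue⇒prev-white : ∀ i → Blue B₀ d (v i) → White d (v (prev i))
        blue⇒prev-white i blue with arc? (v (prev i)) (v i)
        ... | yes a = contradiction blue (arc-into-cycle-white i a)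
        ... | no ¬a = arc-into-cycle-white (prev i) (proj₁ (twist (prev i) ¬a′))
          where
          ¬a′ : ¬ Arc A (v (prev i)) (v (next (prev i)))
          ¬a′ = ¬a ∘ subst (λ j → Arc A (v (prev i)) (v j)) (next-prev i)

        cycle-edge-unforceable : ∀ i → ¬ ForceStep G B₀ d (v i) (v (next i))
        cycle-edge-unforceable i (_ , blue , _ , others-blue) =
          blue⇒prev-white i blue (others-blue (v (prev i)) (adj-prev i) (prev≢next i ∘ inj C _ _))

      cycle-stays-unforced : ∀ d rest → ValidFrom G B₀ d rest → ArcForces (d ++ rest) →
                             CycleUnforced d → CycleUnforced (d ++ rest)
      cycle-stays-unforced d [] _ _ unforced = subst CycleUnforced (sym (++-identityʳ d)) unforced
      cycle-stays-unforced d ((a , b) ∷ rest) (step , valid) arcs unforced =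
        subst CycleUnforced (++-assoc d [ (a , b) ] rest)
          (cycle-stays-unforced (d ++ [ (a , b) ]) rest valid
            (arcs ∘ subst (_ ∈_) (++-assoc d [ (a , b) ] rest)) unforced′)
        where
        unforced′ : CycleUnforced (d ++ [ (a , b) ])
        unforced′ i ab∈ with ∈-++⁻ d ab∈
        ... | inj₁ ab∈d = unforced i ab∈d
        ... | inj₂ (here refl) = cycle-edge-unforceable (arcs ∘ ∈-++⁺ˡ) unforced i step

    chain-twist⇒¬forcing : ContainsChainTwist G A → ¬ ForcingArcSet G A
    chain-twist⇒¬forcing (C , twist) (_ , forces , valid , all-blue , arc⇔force) =
      blue⇒prev-white C twist arcs unforced zero (all-blue _) (all-blue _)
      where
      arcs : ArcForces forces
      arcs = Equivalence.from (arc⇔force _ _)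
      unforced : CycleUnforced C twist forces
      unforced = cycle-stays-unforced C twist [] forces valid arcs (λ _ ())

    module Stalled {d : Forces} (stalled : ∀ {u v} → Arc A u v → ¬ ForceStep G B₀ d u v) where

      Blocks : Fin n → Fin n → Set
      Blocks u w = Adj G u w × White d w × ¬ Arc A u w

      back-spec : ∀ v → Σ (Fin n) λ w →
        (White d v → Arc A w v) × (Blue B₀ d v → ∀ {y} → Arc A v y → White d y → Blocks v w)
      back-spec v with blue? d v
      ... | no white with any? (λ u → arc? u v)
      ...   | yes (u , a) = u , (λ _ → a) , (λ blue → contradiction blue white)
      ...   | no no-in-arc = contradiction (inj₁ λ u a → no-in-arc (u , a)) white
      back-spec v | yes blue with any? (λ w → adj? v w ×-dec white? d w ×-dec ¬? (arc? v w))
      ...   | yes (w , blocks) = w , (λ white → contradiction blue white) , λ _ _ _ → blocks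
      -- Without a blocking neighbour, v could force along its arc; the junk value v is never used.
      ...   | no unblocked =
            v , (λ white → contradiction blue white) , λ _ a white-y → ⊥-elim (stalled a (can-force a white-y))
        where
        can-force : ∀ {y} → Arc A v y → White d y → ForceStep G B₀ d v y
        can-force {y} a white-y = arc-edge A v y a , blue , white-y , λ w vw w≢y →
          decidable-stable (blue? d w) λ white-w → unblocked (w , vw , white-w , λ a′ → w≢y (out-unique a′ a))

      back : Fin n → Fin n
      back v = proj₁ (back-spec v)

      back-of-white : ∀ {v} → White d v → Arc A (back v) v
      back-of-white {v} = proj₁ (proj₂ (back-spec v))

      back-of-blue : ∀ {v y} → Blue B₀ d v → Arc A v y → White d y → Blocks v (back v)
      back-of-blue {v} blue = proj₂ (proj₂ (back-spec v)) blue

      Pending : Fin n → Set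
      Pending v = White d v ⊎ (Blue B₀ d v × ∃ λ y → Arc A v y × White d y)

      back-pending : ∀ {v} → Pending v → Pending (back v)
      back-pending {v} (inj₁ white) with blue? d (back v)
      ... | yes blue    = inj₂ (blue , v , back-of-white white , white)
      ... | no white′   = inj₁ white′
      back-pending (inj₂ (blue , _ , a , white-y)) = inj₁ (proj₁ (proj₂ (back-of-blue blue a white-y)))

      back-adjacent : ∀ {v} → Pending v → Adj G (back v) v
      back-adjacent (inj₁ white) = arc-edge A _ _ (back-of-white white)
      back-adjacent {v} (inj₂ (blue , _ , a , white-y)) =
        trans (adj-sym G (back v) v) (proj₁ (back-of-blue blue a white-y))

      back-no-fixpoint : ∀ {v} → Pending v → back v ≢ v
      back-no-fixpoint {v} (inj₁ white) eq = arc-irreflexive v (subst (λ u → Arc A u v) eq (back-of-white white))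
      back-no-fixpoint (inj₂ (blue , _ , a , white-y)) eq =
        subst (White d) eq (proj₁ (proj₂ (back-of-blue blue a white-y))) blue

      back-no-2-cycle : ∀ {v} → Pending v → back (back v) ≢ v
      back-no-2-cycle {v} (inj₁ white) eq with back-pending (inj₁ white)
      ... | inj₁ white′ = arc-asymmetric (back-of-white white) (subst (λ u → Arc A u (back v)) eq (back-of-white white′))
      ... | inj₂ (blue′ , _ , a , white-y) =
            proj₂ (proj₂ (back-of-blue blue′ a white-y)) (subst (Arc A (back v)) (sym eq) (back-of-white white))
      back-no-2-cycle {v} (inj₂ (blue , _ , a , white-y)) eq =
        proj₂ (proj₂ (back-of-blue blue a white-y)) (subst (λ u → Arc A u (back v)) eq (back-of-white white-back))
        where
        white-back : White d (back v)
        white-back = proj₁ (proj₂ (back-of-blue blue a white-y))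

      back-twist : ∀ {b a c e} → Pending c → Pending e → back a ≡ b → back c ≡ a → back e ≡ c →
                   ¬ Arc A a c → Arc A b a × Arc A c e
      back-twist (inj₁ white-c) _ _ refl _ ¬arc = contradiction (back-of-white white-c) ¬arc
      back-twist (inj₂ (blue-c , _ , a , white-y)) (inj₁ white-e) refl refl refl _ =
        back-of-white (proj₁ (proj₂ (back-of-blue blue-c a white-y))) , back-of-white white-e
      back-twist (inj₂ (blue-c , _ , _ , _)) (inj₂ (blue-e , _ , a , white-y)) _ _ refl _ =
        contradiction blue-c (proj₁ (proj₂ (back-of-blue blue-e a white-y)))

      chain-twist-from-period : ∀ k {y} → Pending y → Period back y (suc k) → ContainsChainTwist G A
      chain-twist-from-period zero          pending period = ⊥-elim (back-no-fixpoint pending (Period.returns period))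
      chain-twist-from-period (suc zero)    pending period = ⊥-elim (back-no-2-cycle pending (Period.returns period))
      chain-twist-from-period (suc (suc m)) pending period
        with reversed-orbit G back-pending back-adjacent m pending period
      ... | C , back-next , pending-C = C , λ i ¬arc →
            back-twist (pending-C (next i)) (pending-C (next (next i)))
                       (back-prev i) (back-next i) (back-next (next i)) ¬arc
        where
        back-prev : ∀ i → back (vtx C i) ≡ vtx C (prev i)
        back-prev i = subst (λ j → back (vtx C j) ≡ vtx C (prev i)) (next-prev i) (back-next (prev i))

      chain-twist : ∀ {w} → White d w → ContainsChainTwist G A
      chain-twist {w} white with eventually-periodic back w
      ... | s , k , period =
            chain-twist-from-period k (fold-preserves {P = Pending} back-pending (inj₁ white) s) period

    Realises : Forces → Set
    Realises forces =
      ValidFrom G B₀ [] forces × (∀ w → Blue B₀ forces w) × (∀ u v → Arc A u v ⇔ (u , v) ∈ forces)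

    greedy : ¬ ContainsChainTwist G A → ∀ d → Acc _<_ (length (whites d)) →
             ValidFrom G B₀ [] d → ArcForces d → Σ Forces Realises
    greedy no-twist d (acc smaller) valid arcs with any? (white? d)
    ... | no no-white = d , valid , all-blue , λ u v → mk⇔ (λ a → arc-into-blue⇒forced arcs a (all-blue v)) arcs
      where
      all-blue : ∀ w → Blue B₀ d w
      all-blue w = decidable-stable (blue? d w) λ white → no-white (w , white)
    ... | yes (_ , white) with any? (λ u → any? λ v → arc? u v ×-dec forceStep? d u v)
    ...   | no stalled = contradiction (Stalled.chain-twist (λ a step → stalled (_ , _ , a , step)) white) no-twist
    ...   | yes (u , v , a , step) =
            greedy no-twist (d ++ [ (u , v) ]) (smaller (forcing-shrinks-whites step))
                   (ValidFrom-snoc [] d valid step) arcs′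
      where
      arcs′ : ArcForces (d ++ [ (u , v) ])
      arcs′ uv∈ with ∈-++⁻ d uv∈
      ... | inj₁ uv∈d = arcs uv∈d
      ... | inj₂ (here refl) = a

    ¬chain-twist⇒forcing : ¬ ContainsChainTwist G A → ForcingArcSet G A
    ¬chain-twist⇒forcing no-twist = p1 , greedy no-twist [] (<-wellFounded _) tt (λ ())

theorem2p4 : (n : ℕ) (G : Graph n) (A : ArcSet G) → P1 A →
    (ForcingArcSet G A ⇔ (¬ ContainsChainTwist G A))
theorem2p4 n G A p1 = mk⇔ (λ forcing twist → chain-twist⇒¬forcing A p1 twist forcing) (¬chain-twist⇒forcing A p1)
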